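{- For a universe $[k]$, let $R\subseteq[k]$ be random, containing each element independently with probability $1/2$, and define $f_R:2^{[k]}\to\mathbb{R}$ by $f_R(S)=-1$ if $S=R$, $f_R(S)=0$ if $S\subsetneq R$ or $R\subsetneq S$, and $f_R(S)=1$ otherwise. Consider algorithms that access $f_R$ only through a subgradient oracle which, given a point $x\in[0,1]^k$ (equivalently a permutation $P$ of $[k]$), returns the Lovasz subgradient $g$ of $f_R$ at $x$, i.e. $g_{P_m}=f_R(P[m])-f_R(P[m-1])$ for $m\in[k]$, and which always find the minimizer $R$ of $f_R$. Let $h(k)$ be the expected number of subgradient oracle calls such an algorithm makes (expectation over $R$). Then $h(n)\ge n/4$; in particular, any such algorithm for submodular function minimization requires $\Omega(n)$ subgradient calls.
   Context: For $x\in\mathbb{R}^n$, the permutation $P=P_x$ consistent with $x$ satisfies $x_{P_1}\ge x_{P_2}\ge\dots\ge x_{P_n}$ with ties broken lexicographically; $P[m]=\{P_1,\dots,P_m\}$ and $P[0]=\emptyset$. The Lovasz subgradient of a set function $f$ at $x$ is $g(x)$ with $g(x)_{P_m}=f(P[m])-f(P[m-1])$. -}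

module Defs where

open import Data.Nat using (ℕ; zero; suc; _+_; _<ᵇ_)
open import Data.Bool using (Bool; true; false)
import Data.Bool.Properties as BoolP
open import Data.Integer using (ℤ; +_; -[1+_]; _-_)
open import Data.Fin using (Fin; toℕ)
open import Data.Fin.Subset using (Subset; _∈_; _⊂_)
open import Data.Fin.Subset.Properties using (_⊂?_)
open import Data.Fin.Permutation using (Permutation′; _⟨$⟩ʳ_; _⟨$⟩ˡ_)
open import Data.Vec using (Vec; []; _∷_; tabulate; lookup; map; _++_)
open import Data.Vec.Properties using (≡-dec)
open import Data.Nat.ListAction using (sum)
open import Data.List using (List; []; _∷_) renaming (map to mapL; _++_ to _++L_)
open import Data.Product using (_×_; _,_; proj₁; proj₂)
open import Relation.Nullary using (yes; no)

f : ∀ {n} → Subset n → Subset n → ℤ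
f R S with ≡-dec BoolP._≟_ S R
... | yes _ = -[1+ 0 ]
... | no _ with S ⊂? R | R ⊂? S
...   | yes _ | _     = + 0
...   | no _  | yes _ = + 0
...   | no _  | no _  = + 1

-- A query is a permutation P of [n] (0-indexed): P_m = P ⟨$⟩ʳ m.
-- Prefix set P[j] = {P_0, …, P_{j-1}}: i ∈ P[j] iff (position of i in P) < j.
prefix : ∀ {n} → Permutation′ n → ℕ → Subset n
prefix P j = tabulate (λ i → toℕ (P ⟨$⟩ˡ i) <ᵇ j)

-- Lovász subgradient of g at P: g_{P_m} = g(P[m+1]) − g(P[m]) (0-indexed m),
-- i.e. for i with m = position of i, g_i = g(P[m+1]) − g(P[m]).
lovaszSubgradient : ∀ {n} → (Subset n → ℤ) → Permutation′ n → Vec ℤ n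
lovaszSubgradient g P =
  tabulate (λ i → g (prefix P (suc (toℕ (P ⟨$⟩ˡ i)))) - g (prefix P (toℕ (P ⟨$⟩ˡ i))))

-- Deterministic adaptive algorithms accessing f_R only through the
-- subgradient oracle: decision trees that either stop with an output set,
-- or query a permutation and continue depending on the returned subgradient.
data Alg (n : ℕ) : Set where
  done  : Subset n → Alg n
  query : Permutation′ n → (Vec ℤ n → Alg n) → Alg n

output : ∀ {n} → Alg n → Subset n → Subset n
output (done S)    R = S
output (query P k) R = output (k (lovaszSubgradient (f R) P)) R

calls : ∀ {n} → Alg n → Subset n → ℕ
calls (done S)    R = 0
calls (query P k) R = suc (calls (k (lovaszSubgradient (f R) P)) R)

allSubsets : ∀ n → List (Subset n)
allSubsets zero    = [] ∷ []
allSubsets (suc n) = mapL (true ∷_) (allSubsets n) ++L mapL (false ∷_) (allSubsets n)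

-- Total number of calls summed over all R (= 2^n · expected number of calls
-- for R uniform, i.e. each element included independently w.p. 1/2).
totalCalls : ∀ {n} → Alg n → ℕ
totalCalls {n} A = sum (mapL (calls A) (allSubsets n))

module Submission where

-- Fix a query order P and a set R.  Call i the *first miss* of R under P if
-- i ∉ R but every element before i in P lies in R, and the *last hit* if
-- i ∈ R and every element of R comes no later than i.  Since f_R(S) depends
-- on R only through the two inclusions S ⊆ R and R ⊆ S, toggling the
-- membership of a single element i changes no answer of the oracle at P
-- unless i is the first miss or the last hit for R or for the toggled set.
--
-- Let charge A R i count the queries of A's run on R in which i plays one of
-- these two roles.  Each query gives charge to at most two elements, so
-- Σᵢ charge A R i ≤ 2 · calls A R.  A correct algorithm must separate R from
-- its toggle flipAt i R, so charge A R i + charge A (flipAt i R) i ≥ 1 for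
-- every i.  Summing over all R and i, and using that R ↦ flipAt i R permutes
-- the subsets, gives n · 2ⁿ ≤ 2 · Σ_R Σᵢ charge A R i ≤ 4 · totalCalls A.

open import Defs
import Algebra.Properties.Semiring.Sum as FinSum
open import Data.Bool using (Bool; true; false; not)
import Data.Bool.Properties as BoolP
open import Data.Fin using (Fin; zero; suc; toℕ; _≟_)
open import Data.Fin.Permutation using (Permutation′; _⟨$⟩ʳ_; _⟨$⟩ˡ_; inverseʳ)
open import Data.Fin.Properties using (all?; toℕ-injective; suc-injective)
open import Data.Fin.Subset using (Subset; _∈_; _∉_; _⊆_; _⊂_; inside; outside)
open import Data.Fin.Subset.Properties
  using (_∈?_; _⊆?_; _⊂?_; ⊆-refl; ⊆-antisym; drop-∷-⊆; out⊂; out⊂in; s⊂s)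
open import Data.Integer using (ℤ; _-_; -1ℤ; 0ℤ; 1ℤ) renaming (_≟_ to _≟ℤ_)
open import Data.List using (List; []; _∷_; length) renaming (map to mapL; _++_ to _++L_)
import Data.List.Properties as ListP
open import Data.Nat using (ℕ; zero; suc; _+_; _*_; _^_; _≤_; _<_; z≤n; s≤s; _<?_; _≤?_)
open import Data.Nat.ListAction using (sum)
open import Data.Nat.ListAction.Properties using (sum-++)
open import Data.Nat.Properties
  using ( <ᵇ⇒<; <⇒<ᵇ; <-cmp; <-irrefl; <-trans; <⇒≤; <-≤-trans; ≮⇒≥; ≤-refl; ≤-reflexive; ≤-trans
        ; ≤-antisym; +-mono-≤; m≤m+n; m≤n+m; +-assoc; +-comm; +-identityʳ; *-comm; *-zeroʳ
        ; *-distribˡ-+; *-distribʳ-+; +-*-semiring; +-commutativeSemigroup; module ≤-Reasoning )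
open import Data.Product using (_×_; _,_)
open import Data.Vec using (Vec; []; _∷_; lookup; updateAt; here)
open import Data.Vec.Properties
  using (≡-dec; []=⇒lookup; lookup⇒[]=; lookup∘tabulate; tabulate-cong; lookup∘updateAt; lookup∘updateAt′)
open import Function using (_∘_; _⇔_; mk⇔; Equivalence)
open import Relation.Binary using (tri<; tri≈; tri>)
open import Relation.Binary.PropositionalEquality
open import Relation.Nullary using (Dec; yes; no; ¬_; does; contradiction; ¬?; _×-dec_; _→-dec_)
open import Relation.Nullary.Decidable using (dec-true; dec-false; does-⇔)

open import Algebra.Properties.CommutativeSemigroup +-commutativeSemigroup using (interchange)
open FinSum +-*-semiring using (sum-syntax; sum-cong-≗; sum-replicate-zero; ∑-distrib-+)

private
  variable
    n : ℕ

-- 1. f_R(S) depends on R only through S ⊆ R and R ⊆ S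

⊆∧≢⇒⊂ : {p q : Subset n} → p ⊆ q → p ≢ q → p ⊂ q
⊆∧≢⇒⊂ {p = []}          {[]}          _   p≢q = contradiction refl p≢q
⊆∧≢⇒⊂ {p = outside ∷ p} {inside ∷ q}  p⊆q _   = out⊂in (drop-∷-⊆ p⊆q)
⊆∧≢⇒⊂ {p = inside ∷ p}  {outside ∷ q} p⊆q _   = contradiction (p⊆q here) λ ()
⊆∧≢⇒⊂ {p = outside ∷ p} {outside ∷ q} p⊆q p≢q = out⊂ (⊆∧≢⇒⊂ (drop-∷-⊆ p⊆q) (p≢q ∘ cong (outside ∷_)))
⊆∧≢⇒⊂ {p = inside ∷ p}  {inside ∷ q}  p⊆q p≢q = s⊂s (⊆∧≢⇒⊂ (drop-∷-⊆ p⊆q) (p≢q ∘ cong (inside ∷_)))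

shape : Bool → Bool → ℤ
shape true  true  = -1ℤ
shape true  false = 0ℤ
shape false true  = 0ℤ
shape false false = 1ℤ

f-shape : (R S : Subset n) → f R S ≡ shape (does (S ⊆? R)) (does (R ⊆? S))
f-shape R S with ≡-dec BoolP._≟_ S R
... | yes refl rewrite dec-true (R ⊆? R) ⊆-refl = refl
... | no S≢R with S ⊂? R | R ⊂? S
...   | yes (S⊆R , _) | _
      rewrite dec-true (S ⊆? R) S⊆R | dec-false (R ⊆? S) (S≢R ∘ ⊆-antisym S⊆R) = refl
...   | no _ | yes (R⊆S , _)
      rewrite dec-false (S ⊆? R) (λ S⊆R → S≢R (⊆-antisym S⊆R R⊆S)) | dec-true (R ⊆? S) R⊆S = refl
...   | no S⊄R | no R⊄S
      rewrite dec-false (S ⊆? R) (λ S⊆R → S⊄R (⊆∧≢⇒⊂ S⊆R S≢R))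
            | dec-false (R ⊆? S) (λ R⊆S → R⊄S (⊆∧≢⇒⊂ R⊆S (S≢R ∘ sym))) = refl

f-determined : {R R′ S : Subset n} → (S ⊆ R ⇔ S ⊆ R′) → (R ⊆ S ⇔ R′ ⊆ S) → f R S ≡ f R′ S
f-determined {R = R} {R′} {S} below above = begin
  f R S                                            ≡⟨ f-shape R S ⟩
  shape (does (S ⊆? R))  (does (R ⊆? S))           ≡⟨ cong₂ shape (does-⇔ below (S ⊆? R) (S ⊆? R′))
                                                                  (does-⇔ above (R ⊆? S) (R′ ⊆? S)) ⟩
  shape (does (S ⊆? R′)) (does (R′ ⊆? S))          ≡⟨ f-shape R′ S ⟨
  f R′ S                                           ∎
  where open ≡-Reasoning

-- 2. Positions, prefixes, first misses and last hits

pos : Permutation′ n → Fin n → ℕ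
pos P i = toℕ (P ⟨$⟩ˡ i)

pos-injective : (P : Permutation′ n) {i j : Fin n} → pos P i ≡ pos P j → i ≡ j
pos-injective P {i} {j} eq = begin
  i                          ≡⟨ inverseʳ P ⟨
  P ⟨$⟩ʳ (P ⟨$⟩ˡ i)          ≡⟨ cong (P ⟨$⟩ʳ_) (toℕ-injective eq) ⟩
  P ⟨$⟩ʳ (P ⟨$⟩ˡ j)          ≡⟨ inverseʳ P ⟩
  j                          ∎
  where open ≡-Reasoning

∈-prefix⇒< : (P : Permutation′ n) (j : ℕ) {x : Fin n} → x ∈ prefix P j → pos P x < j
∈-prefix⇒< P j {x} x∈P =
  <ᵇ⇒< (pos P x) j (Equivalence.from BoolP.T-≡ (trans (sym (lookup∘tabulate _ x)) ([]=⇒lookup x∈P)))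

<⇒∈-prefix : (P : Permutation′ n) (j : ℕ) {x : Fin n} → pos P x < j → x ∈ prefix P j
<⇒∈-prefix P j {x} x<j =
  lookup⇒[]= x (prefix P j) (trans (lookup∘tabulate _ x) (Equivalence.to BoolP.T-≡ (<⇒<ᵇ x<j)))

FirstMiss : Permutation′ n → Subset n → Fin n → Set
FirstMiss P R i = i ∉ R × (∀ y → pos P y < pos P i → y ∈ R)

LastHit : Permutation′ n → Subset n → Fin n → Set
LastHit P R i = i ∈ R × (∀ y → y ∈ R → pos P y ≤ pos P i)

firstMiss? : (P : Permutation′ n) (R : Subset n) (i : Fin n) → Dec (FirstMiss P R i)
firstMiss? P R i = ¬? (i ∈? R) ×-dec all? (λ y → (pos P y <? pos P i) →-dec (y ∈? R))

lastHit? : (P : Permutation′ n) (R : Subset n) (i : Fin n) → Dec (LastHit P R i)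
lastHit? P R i = (i ∈? R) ×-dec all? (λ y → (y ∈? R) →-dec (pos P y ≤? pos P i))

firstMiss-unique : (P : Permutation′ n) (R : Subset n) {i j : Fin n} →
                   FirstMiss P R i → FirstMiss P R j → i ≡ j
firstMiss-unique P R {i} {j} (i∉R , beforeI∈R) (j∉R , beforeJ∈R) with <-cmp (pos P i) (pos P j)
... | tri< i<j _ _ = contradiction (beforeJ∈R i i<j) i∉R
... | tri≈ _ i=j _ = pos-injective P i=j
... | tri> _ _ j<i = contradiction (beforeI∈R j j<i) j∉R

lastHit-unique : (P : Permutation′ n) (R : Subset n) {i j : Fin n} →
                 LastHit P R i → LastHit P R j → i ≡ j
lastHit-unique P R (i∈R , ≤i) (j∈R , ≤j) = pos-injective P (≤-antisym (≤j _ i∈R) (≤i _ j∈R))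

-- 3. Toggling one coordinate, and what the oracle sees of it

record Toggled (i : Fin n) (R R′ : Subset n) : Set where
  constructor toggled
  field
    unchanged : ∀ y → y ≢ i → lookup R′ y ≡ lookup R y
    flipped   : lookup R′ i ≡ not (lookup R i)

flipAt : Fin n → Subset n → Subset n
flipAt i R = updateAt R i not

flipAt-toggles : (i : Fin n) (R : Subset n) → Toggled i R (flipAt i R)
flipAt-toggles i R = toggled (λ y y≢i → lookup∘updateAt′ y i y≢i R) (lookup∘updateAt i R)

flipAt-changes : (i : Fin n) (R : Subset n) → R ≢ flipAt i R
flipAt-changes i R R≡R′ = BoolP.not-¬ refl (trans (cong (λ S → lookup S i) R≡R′) (lookup∘updateAt i R))

toggled-sym : {i : Fin n} {R R′ : Subset n} → Toggled i R R′ → Toggled i R′ R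
toggled-sym (toggled unchanged flipped) =
  toggled (λ y y≢i → sym (unchanged y y≢i)) (trans (sym (BoolP.not-involutive _)) (cong not (sym flipped)))

toggled-agree : {i y : Fin n} {R R′ : Subset n} → Toggled i R R′ → y ≢ i → y ∈ R → y ∈ R′
toggled-agree {y = y} {R′ = R′} t y≢i y∈R =
  lookup⇒[]= y R′ (trans (Toggled.unchanged t y y≢i) ([]=⇒lookup y∈R))

toggled-removes : {i : Fin n} {R R′ : Subset n} → Toggled i R R′ → i ∈ R → i ∉ R′
toggled-removes t i∈R i∈R′
  with trans (sym ([]=⇒lookup i∈R′)) (trans (Toggled.flipped t) (cong not ([]=⇒lookup i∈R)))
... | ()

<-pos⇒≢ : (P : Permutation′ n) {x y : Fin n} → pos P y < pos P x → y ≢ x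
<-pos⇒≢ P y<x refl = <-irrefl refl y<x

prefix⊆-transfer : (P : Permutation′ n) (j : ℕ) {i : Fin n} {R R′ : Subset n} →
                   Toggled i R R′ → ¬ FirstMiss P R′ i → prefix P j ⊆ R → prefix P j ⊆ R′
prefix⊆-transfer P j {i} {R′ = R′} t notFirst P[j]⊆R {x} x∈P[j] with x ≟ i
... | no x≢i   = toggled-agree t x≢i (P[j]⊆R x∈P[j])
... | yes refl = contradiction (toggled-removes t (P[j]⊆R x∈P[j]) , earlier∈R′) notFirst
  where
  earlier∈R′ : ∀ y → pos P y < pos P x → y ∈ R′
  earlier∈R′ y y<x =
    toggled-agree t (<-pos⇒≢ P y<x) (P[j]⊆R (<⇒∈-prefix P j (<-trans y<x (∈-prefix⇒< P j x∈P[j]))))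

⊆prefix-transfer : (P : Permutation′ n) (j : ℕ) {i : Fin n} {R R′ : Subset n} →
                   Toggled i R R′ → ¬ LastHit P R′ i → R ⊆ prefix P j → R′ ⊆ prefix P j
⊆prefix-transfer P j {i} {R′ = R′} t notLast R⊆P[j] {x} x∈R′ with x ≟ i
... | no x≢i = R⊆P[j] (toggled-agree (toggled-sym t) x≢i x∈R′)
... | yes refl with pos P x <? j
...   | yes x<j = <⇒∈-prefix P j x<j
...   | no x≮j  = contradiction (x∈R′ , noneLater) notLast
  where
  noneLater : ∀ y → y ∈ R′ → pos P y ≤ pos P x
  noneLater y y∈R′ with y ≟ x
  ... | yes refl = ≤-refl
  ... | no y≢x   =
    <⇒≤ (<-≤-trans (∈-prefix⇒< P j (R⊆P[j] (toggled-agree (toggled-sym t) y≢x y∈R′))) (≮⇒≥ x≮j))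

answer : Subset n → Permutation′ n → Vec ℤ n
answer R P = lovaszSubgradient (f R) P

same-answer : (P : Permutation′ n) {i : Fin n} {R R′ : Subset n} → Toggled i R R′ →
              ¬ FirstMiss P R i → ¬ LastHit P R i → ¬ FirstMiss P R′ i → ¬ LastHit P R′ i →
              answer R P ≡ answer R′ P
same-answer P {R = R} {R′} t notFirst notLast notFirst′ notLast′ =
  tabulate-cong (λ x → cong₂ _-_ (same-on-prefix (suc (pos P x))) (same-on-prefix (pos P x)))
  where
  same-on-prefix : ∀ j → f R (prefix P j) ≡ f R′ (prefix P j)
  same-on-prefix j = f-determined
    (mk⇔ (prefix⊆-transfer P j t notFirst′) (prefix⊆-transfer P j (toggled-sym t) notFirst))
    (mk⇔ (⊆prefix-transfer P j t notLast′)  (⊆prefix-transfer P j (toggled-sym t) notLast))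

-- 4. Charging queries to elements

∑-mono : {g h : Fin n → ℕ} → (∀ i → g i ≤ h i) → ∑[ i < n ] g i ≤ ∑[ i < n ] h i
∑-mono {zero}  g≤h = z≤n
∑-mono {suc n} g≤h = +-mono-≤ (g≤h zero) (∑-mono (g≤h ∘ suc))

∑-const-1 : ∀ n → ∑[ i < n ] 1 ≡ n
∑-const-1 zero    = refl
∑-const-1 (suc n) = cong suc (∑-const-1 n)

indicator : {A : Set} → Dec A → ℕ
indicator (yes _) = 1
indicator (no _)  = 0

roles : Permutation′ n → Subset n → Fin n → ℕ
roles P R i = indicator (firstMiss? P R i) + indicator (lastHit? P R i)

charge : Alg n → Subset n → Fin n → ℕ
charge (done _)    R i = 0
charge (query P k) R i = roles P R i + charge (k (answer R P)) R i

indicator-none : {Q : Fin n → Set} (Q? : ∀ i → Dec (Q i)) → (∀ i → ¬ Q i) →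
                 ∑[ i < n ] indicator (Q? i) ≡ 0
indicator-none {zero}  Q? none = refl
indicator-none {suc n} Q? none with Q? zero
... | yes q = contradiction q (none zero)
... | no _  = indicator-none (Q? ∘ suc) (none ∘ suc)

indicator-unique : {Q : Fin n → Set} (Q? : ∀ i → Dec (Q i)) → (∀ {i j} → Q i → Q j → i ≡ j) →
                   ∑[ i < n ] indicator (Q? i) ≤ 1
indicator-unique {zero}  Q? unique = z≤n
indicator-unique {suc n} Q? unique with Q? zero
... | yes q = ≤-reflexive (cong suc (indicator-none (Q? ∘ suc) (λ i qi → 0≢suc (unique q qi))))
  where
  0≢suc : {i : Fin n} → zero ≢ suc i
  0≢suc ()
... | no _  = indicator-unique (Q? ∘ suc) (λ qi qj → suc-injective (unique qi qj))

roles-sum : (P : Permutation′ n) (R : Subset n) → ∑[ i < n ] roles P R i ≤ 2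
roles-sum P R = begin
  ∑[ i < _ ] roles P R i
    ≡⟨ ∑-distrib-+ (indicator ∘ firstMiss? P R) (indicator ∘ lastHit? P R) ⟩
  ∑[ i < _ ] indicator (firstMiss? P R i) + ∑[ i < _ ] indicator (lastHit? P R i)
    ≤⟨ +-mono-≤ (indicator-unique (firstMiss? P R) (firstMiss-unique P R))
                (indicator-unique (lastHit? P R) (lastHit-unique P R)) ⟩
  2
    ∎
  where open ≤-Reasoning

charge-sum : (A : Alg n) (R : Subset n) → ∑[ i < n ] charge A R i ≤ 2 * calls A R
charge-sum {n} (done _) R = ≤-reflexive (sum-replicate-zero n)
charge-sum (query P k) R = begin
  ∑[ i < _ ] (roles P R i + charge (k (answer R P)) R i)
    ≡⟨ ∑-distrib-+ (roles P R) (charge (k (answer R P)) R) ⟩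
  ∑[ i < _ ] roles P R i + ∑[ i < _ ] charge (k (answer R P)) R i
    ≤⟨ +-mono-≤ (roles-sum P R) (charge-sum (k (answer R P)) R) ⟩
  2 + 2 * calls (k (answer R P)) R
    ≡⟨ *-distribˡ-+ 2 1 _ ⟨
  2 * calls (query P k) R
    ∎
  where open ≤-Reasoning

roles-detect : (P : Permutation′ n) {i : Fin n} {R R′ : Subset n} → Toggled i R R′ →
               answer R P ≢ answer R′ P → 1 ≤ roles P R i + roles P R′ i
roles-detect P {i} {R} {R′} t distinct
  with firstMiss? P R i | lastHit? P R i | firstMiss? P R′ i | lastHit? P R′ i
... | yes _ | _     | _     | _     = s≤s z≤n
... | no _  | yes _ | _     | _     = s≤s z≤n
... | no _  | no _  | yes _ | _     = s≤s z≤n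
... | no _  | no _  | no _  | yes _ = s≤s z≤n
... | no notFirst | no notLast | no notFirst′ | no notLast′ =
  contradiction (same-answer P t notFirst notLast notFirst′ notLast′) distinct

toggle-detected : (A : Alg n) {i : Fin n} {R R′ : Subset n} → Toggled i R R′ →
                  output A R ≢ output A R′ → 1 ≤ charge A R i + charge A R′ i
toggle-detected (done S) t differ = contradiction refl differ
toggle-detected (query P k) {i} {R} {R′} t differ with ≡-dec _≟ℤ_ (answer R P) (answer R′ P)
... | no distinct = ≤-trans (roles-detect P t distinct)
                            (+-mono-≤ (m≤m+n (roles P R i) _) (m≤m+n (roles P R′ i) _))
... | yes same = begin
  1
    ≤⟨ toggle-detected (k g) t differ′ ⟩
  charge (k g) R i + charge (k g) R′ i
    ≡⟨ cong (λ h → charge (k g) R i + charge (k h) R′ i) same ⟩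
  charge (k g) R i + charge (k (answer R′ P)) R′ i
    ≤⟨ +-mono-≤ (m≤n+m _ (roles P R i)) (m≤n+m _ (roles P R′ i)) ⟩
  charge (query P k) R i + charge (query P k) R′ i
    ∎
  where
  open ≤-Reasoning
  g = answer R P
  differ′ : output (k g) R ≢ output (k g) R′
  differ′ eq = differ (trans eq (cong (λ h → output (k h) R′) same))

toggle-charged : (A : Alg n) → (∀ R → output A R ≡ R) → (R : Subset n) →
                 n ≤ ∑[ i < n ] charge A R i + ∑[ i < n ] charge A (flipAt i R) i
toggle-charged {n} A correct R = begin
  n
    ≡⟨ ∑-const-1 n ⟨
  ∑[ i < n ] 1
    ≤⟨ ∑-mono (λ i → toggle-detected A (flipAt-toggles i R) (separated i)) ⟩
  ∑[ i < n ] (charge A R i + charge A (flipAt i R) i)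
    ≡⟨ ∑-distrib-+ (charge A R) (λ i → charge A (flipAt i R) i) ⟩
  ∑[ i < n ] charge A R i + ∑[ i < n ] charge A (flipAt i R) i
    ∎
  where
  open ≤-Reasoning
  separated : ∀ i → output A R ≢ output A (flipAt i R)
  separated i eq = flipAt-changes i R (trans (sym (correct R)) (trans eq (correct (flipAt i R))))

module _ {A : Set} where

  sumOver : (A → ℕ) → List A → ℕ
  sumOver F xs = sum (mapL F xs)

  sumOver-mono : {F G : A → ℕ} (xs : List A) → (∀ x → F x ≤ G x) → sumOver F xs ≤ sumOver G xs
  sumOver-mono []       F≤G = z≤n
  sumOver-mono (x ∷ xs) F≤G = +-mono-≤ (F≤G x) (sumOver-mono xs F≤G)

  sumOver-+ : (F G : A → ℕ) (xs : List A) → sumOver (λ x → F x + G x) xs ≡ sumOver F xs + sumOver G xs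
  sumOver-+ F G []       = refl
  sumOver-+ F G (x ∷ xs) =
    trans (cong ((F x + G x) +_) (sumOver-+ F G xs)) (interchange (F x) (G x) (sumOver F xs) _)

  sumOver-* : (c : ℕ) (F : A → ℕ) (xs : List A) → sumOver (λ x → c * F x) xs ≡ c * sumOver F xs
  sumOver-* c F []       = sym (*-zeroʳ c)
  sumOver-* c F (x ∷ xs) = trans (cong (c * F x +_) (sumOver-* c F xs)) (sym (*-distribˡ-+ c (F x) _))

  sumOver-const : (c : ℕ) (xs : List A) → sumOver (λ _ → c) xs ≡ length xs * c
  sumOver-const c []       = refl
  sumOver-const c (x ∷ xs) = cong (c +_) (sumOver-const c xs)

  sumOver-∑-comm : (G : A → Fin n → ℕ) (xs : List A) →
                   sumOver (λ x → ∑[ i < n ] G x i) xs ≡ ∑[ i < n ] sumOver (λ x → G x i) xs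
  sumOver-∑-comm {n} G []       = sym (sum-replicate-zero n)
  sumOver-∑-comm {n} G (x ∷ xs) = begin
    ∑[ i < n ] G x i + sumOver (λ x → ∑[ i < n ] G x i) xs
      ≡⟨ cong (∑[ i < n ] G x i +_) (sumOver-∑-comm G xs) ⟩
    ∑[ i < n ] G x i + ∑[ i < n ] sumOver (λ x → G x i) xs
      ≡⟨ ∑-distrib-+ (G x) (λ i → sumOver (λ x → G x i) xs) ⟨
    ∑[ i < n ] (G x i + sumOver (λ x → G x i) xs)
      ∎
    where open ≡-Reasoning

sumSubsets : (Subset n → ℕ) → ℕ
sumSubsets {n} F = sumOver F (allSubsets n)

sumSubsets-split : (F : Subset (suc n) → ℕ) →
                   sumSubsets F ≡ sumSubsets (λ R → F (inside ∷ R)) + sumSubsets (λ R → F (outside ∷ R))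
sumSubsets-split {n} F = begin
  sum (mapL F (mapL (inside ∷_) L ++L mapL (outside ∷_) L))
    ≡⟨ cong sum (ListP.map-++ F (mapL (inside ∷_) L) _) ⟩
  sum (mapL F (mapL (inside ∷_) L) ++L mapL F (mapL (outside ∷_) L))
    ≡⟨ sum-++ (mapL F (mapL (inside ∷_) L)) _ ⟩
  sum (mapL F (mapL (inside ∷_) L)) + sum (mapL F (mapL (outside ∷_) L))
    ≡⟨ cong₂ _+_ (cong sum (ListP.map-∘ L)) (cong sum (ListP.map-∘ L)) ⟨
  sumSubsets (λ R → F (inside ∷ R)) + sumSubsets (λ R → F (outside ∷ R))
    ∎
  where
  open ≡-Reasoning
  L = allSubsets n

-- Toggling a fixed coordinate permutes the subsets, so it preserves sums.
sumSubsets-flipAt : (i : Fin n) (F : Subset n → ℕ) → sumSubsets (F ∘ flipAt i) ≡ sumSubsets F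
sumSubsets-flipAt {suc n} zero F = begin
  sumSubsets (F ∘ flipAt zero)
    ≡⟨ sumSubsets-split (F ∘ flipAt zero) ⟩
  sumSubsets (λ R → F (outside ∷ R)) + sumSubsets (λ R → F (inside ∷ R))
    ≡⟨ +-comm (sumSubsets (λ R → F (outside ∷ R))) _ ⟩
  sumSubsets (λ R → F (inside ∷ R)) + sumSubsets (λ R → F (outside ∷ R))
    ≡⟨ sumSubsets-split F ⟨
  sumSubsets F
    ∎
  where open ≡-Reasoning
sumSubsets-flipAt {suc n} (suc i) F = begin
  sumSubsets (F ∘ flipAt (suc i))
    ≡⟨ sumSubsets-split (F ∘ flipAt (suc i)) ⟩
  sumSubsets (λ R → F (inside ∷ flipAt i R)) + sumSubsets (λ R → F (outside ∷ flipAt i R))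
    ≡⟨ cong₂ _+_ (sumSubsets-flipAt i (F ∘ (inside ∷_))) (sumSubsets-flipAt i (F ∘ (outside ∷_))) ⟩
  sumSubsets (λ R → F (inside ∷ R)) + sumSubsets (λ R → F (outside ∷ R))
    ≡⟨ sumSubsets-split F ⟨
  sumSubsets F
    ∎
  where open ≡-Reasoning

sumSubsets-∑-flipAt : (G : Subset n → Fin n → ℕ) →
                      sumSubsets (λ R → ∑[ i < n ] G (flipAt i R) i) ≡ sumSubsets (λ R → ∑[ i < n ] G R i)
sumSubsets-∑-flipAt {n} G = begin
  sumSubsets (λ R → ∑[ i < n ] G (flipAt i R) i)
    ≡⟨ sumOver-∑-comm (λ R i → G (flipAt i R) i) (allSubsets n) ⟩
  ∑[ i < n ] sumSubsets (λ R → G (flipAt i R) i)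
    ≡⟨ sum-cong-≗ (λ i → sumSubsets-flipAt i (λ R → G R i)) ⟩
  ∑[ i < n ] sumSubsets (λ R → G R i)
    ≡⟨ sumOver-∑-comm G (allSubsets n) ⟨
  sumSubsets (λ R → ∑[ i < n ] G R i)
    ∎
  where open ≡-Reasoning

length-allSubsets : ∀ n → length (allSubsets n) ≡ 2 ^ n
length-allSubsets zero    = refl
length-allSubsets (suc n) = begin
  length (mapL (inside ∷_) L ++L mapL (outside ∷_) L)
    ≡⟨ ListP.length-++ (mapL (inside ∷_) L) ⟩
  length (mapL (inside ∷_) L) + length (mapL (outside ∷_) L)
    ≡⟨ cong₂ _+_ (ListP.length-map _ L) (ListP.length-map _ L) ⟩
  length L + length L
    ≡⟨ cong₂ _+_ (length-allSubsets n) (length-allSubsets n) ⟩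
  2 ^ n + 2 ^ n
    ≡⟨ cong (2 ^ n +_) (+-identityʳ (2 ^ n)) ⟨
  2 ^ suc n
    ∎
  where
  open ≡-Reasoning
  L = allSubsets n

totalCharge-bound : (A : Alg n) → sumSubsets (λ R → ∑[ i < n ] charge A R i) ≤ 2 * totalCalls A
totalCharge-bound {n} A = begin
  sumSubsets (λ R → ∑[ i < n ] charge A R i)   ≤⟨ sumOver-mono (allSubsets n) (charge-sum A) ⟩
  sumSubsets (λ R → 2 * calls A R)             ≡⟨ sumOver-* 2 (calls A) (allSubsets n) ⟩
  2 * totalCalls A                             ∎
  where open ≤-Reasoning

theorem4p4 : (n : ℕ) (A : Alg n) → (∀ R → output A R ≡ R) → n * 2 ^ n ≤ 4 * totalCalls A
theorem4p4 n A correct = begin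
  n * 2 ^ n                                        ≡⟨ *-comm n (2 ^ n) ⟩
  2 ^ n * n                                        ≡⟨ cong (_* n) (length-allSubsets n) ⟨
  length (allSubsets n) * n                        ≡⟨ sumOver-const n (allSubsets n) ⟨
  sumSubsets {n} (λ _ → n)                         ≤⟨ sumOver-mono (allSubsets n) (toggle-charged A correct) ⟩
  sumSubsets (λ R → C R + C′ R)                    ≡⟨ sumOver-+ C C′ (allSubsets n) ⟩
  sumSubsets C + sumSubsets C′                     ≡⟨ cong (sumSubsets C +_) (sumSubsets-∑-flipAt (charge A)) ⟩
  sumSubsets C + sumSubsets C                      ≤⟨ +-mono-≤ (totalCharge-bound A) (totalCharge-bound A) ⟩
  2 * totalCalls A + 2 * totalCalls A              ≡⟨ *-distribʳ-+ (totalCalls A) 2 2 ⟨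
  4 * totalCalls A                                 ∎
  where
  open ≤-Reasoning
  C C′ : Subset n → ℕ
  C  R = ∑[ i < n ] charge A R i
  C′ R = ∑[ i < n ] charge A (flipAt i R) i
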